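{- Let $G$ be a $4$-cycle free $d$-regular connected finite simple graph on at least $3$ vertices. If $\phi(G)$ is a complete graph on $d^2-d+1$ vertices, then $d=2$.
   Context: $4$-cycle free means $|\mathcal{N}(u)\cap\mathcal{N}(v)|\le1$ for all distinct vertices $u,v$, where $\mathcal{N}(v)$ is the set of neighbors of $v$. The neighborhood graph $\phi(G)$ of $G=(V,E)$ has vertex set $V$, and distinct $u,v$ are adjacent in $\phi(G)$ iff $|\mathcal{N}(u)\cap\mathcal{N}(v)|\ge1$. -}

module Defs where

open import Data.Nat using (ℕ; _≤_)
open import Data.Product using (_×_)
open import Data.Bool using (Bool; true; false; _∧_)
open import Data.Fin using (Fin)
open import Data.List using (List; length; filterᵇ; allFin)
open import Relation.Binary.PropositionalEquality using (_≡_; _≢_)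
open import Relation.Binary.Construct.Closure.ReflexiveTransitive using (Star)

record SimpleGraph (n : ℕ) : Set where
  field
    adj    : Fin n → Fin n → Bool
    sym    : ∀ u v → adj u v ≡ adj v u
    irrefl : ∀ v → adj v v ≡ false

module _ {n : ℕ} (G : SimpleGraph n) where
  open SimpleGraph G

  Adj : Fin n → Fin n → Set
  Adj u v = adj u v ≡ true

  neighbours : Fin n → List (Fin n)
  neighbours v = filterᵇ (adj v) (allFin n)

  degree : Fin n → ℕ
  degree v = length (neighbours v)

  commonNeighbours : Fin n → Fin n → List (Fin n)
  commonNeighbours u v = filterᵇ (λ w → adj u w ∧ adj v w) (allFin n)

  IsRegular : ℕ → Set
  IsRegular d = ∀ v → degree v ≡ d

  IsConnected : Set
  IsConnected = ∀ u v → Star Adj u v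

  FourCycleFree : Set
  FourCycleFree = ∀ u v → u ≢ v → length (commonNeighbours u v) ≤ 1

  PhiAdj : Fin n → Fin n → Set
  PhiAdj u v = u ≢ v × (1 ≤ length (commonNeighbours u v))

  PhiComplete : Set
  PhiComplete = ∀ u v → u ≢ v → PhiAdj u v

-- Write k = d and c = d − 1.  Regularity, the 4-cycle condition and completeness of φ(G) say
-- that the adjacency matrix satisfies A² = J + cI, so the number T m of closed walks of length
-- m + 1 satisfies T 1 = n k and T (m + 2) = n kᵐ⁺¹ + c · T m.  If d ≥ 3, let p be a prime
-- dividing c.  As n = 1 + c k, every T (m + 1) is ≡ 1 (mod p).  But rotating a closed walk
-- of length p generates an orbit of size p unless the walk is constant, and constant walks do
-- not exist in a graph without loops; hence p divides T (p − 1), which is absurd.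
module Submission where

open import Data.Bool.Base using (Bool; true; false; _∧_)
open import Data.Bool.Properties using (∧-idem)
open import Data.Fin.Base using (Fin; zero; suc; toℕ; fromℕ<)
import Data.Fin.Properties as Fin
open import Data.List.Base using (List; []; _∷_; _++_; [_]; length; filterᵇ; tabulate)
open import Data.List.Properties using (++-assoc; ++-identityʳ)
open import Data.List.Relation.Unary.All using (_∷_)
import Data.Nat as ℕ
open import Data.Nat.Base
  using (ℕ; zero; suc; 2+; _+_; _*_; _^_; _∸_; _≤_; _<_; z≤n; s≤s; s≤s⁻¹; NonZero; >-nonZero; >-nonZero⁻¹)
open import Data.Nat.Coprimality using (coprime-Bézout; prime⇒coprime)
open import Data.Nat.Divisibility
  using (_∣_; divides; _∣0; ∣-refl; ∣m∣n⇒∣m+n; ∣m⇒∣m*n; ∣1⇒≡1; ∣m+n∣m⇒∣n)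
open import Data.Nat.DivMod using (_%_; _/_; m≡m%n+[m/n]*n; m%n<n)
open import Data.Nat.GCD using (module Bézout)
open import Data.Nat.GeneralisedArithmetic using (fold; fold-+)
open import Data.Nat.ListAction using (product)
open import Data.Nat.Primality using (Prime; prime⇒nonZero)
open import Data.Nat.Primality.Factorisation using (factorise)
open import Data.Nat.Properties
  using ( +-*-semiring; +-comm; +-identityʳ; *-comm; *-assoc; *-identityˡ; *-identityʳ; *-zeroʳ
        ; *-distribʳ-+; m+n∸m≡n; m∸n+n≡m; 0∸n≡0; ≤-reflexive; ≤-trans; ≤-antisym; <-≤-trans; <⇒≤
        ; <-cmp; n≮0; n<1+n; n≢0⇒n>0; m≤m+n; m<m+n; m<n⇒0<n∸m; +-monoʳ-<)
open import Data.Product.Base using (_×_; _,_; proj₂; ∃-syntax)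
open import Data.Vec.Base using (Vec; []; _∷_; _∷ʳ_; toList)
import Data.Vec.Properties as Vec
open import Data.Vec.Relation.Binary.Equality.Cast using (cast-is-id)
open import Function.Base using (_∘_; id; case_of_)
open import Relation.Binary.Definitions using (DecidableEquality; tri<; tri≈; tri>)
open import Relation.Binary.PropositionalEquality
  using (_≡_; _≢_; refl; sym; trans; cong; cong₂; subst; module ≡-Reasoning)
open import Relation.Nullary.Decidable.Core using (does; yes; no)
open import Relation.Nullary.Negation.Core using (¬_; contradiction)
import Algebra.Properties.Semiring.Sum +-*-semiring as Sum
open Sum using (sum; sum-syntax)

open import Defs

Bool→ℕ : Bool → ℕ
Bool→ℕ true  = 1
Bool→ℕ false = 0

Bool→ℕ-∧ : ∀ x y → Bool→ℕ (x ∧ y) ≡ Bool→ℕ x * Bool→ℕ y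
Bool→ℕ-∧ true  y = sym (+-identityʳ (Bool→ℕ y))
Bool→ℕ-∧ false y = refl

module _ {X : Set} (_≟_ : DecidableEquality X) where

  δ : X → X → ℕ
  δ x y = Bool→ℕ (does (x ≟ y))

  δ-refl : ∀ x → δ x x ≡ 1
  δ-refl x with x ≟ x
  ... | yes _  = refl
  ... | no x≢x = contradiction refl x≢x

  δ-≢ : ∀ {x y} → x ≢ y → δ x y ≡ 0
  δ-≢ {x} {y} x≢y with x ≟ y
  ... | yes x≡y = contradiction x≡y x≢y
  ... | no _    = refl

  δ-pos : ∀ {x y} → 0 < δ x y → x ≡ y
  δ-pos {x} {y} 0<δ with x ≟ y
  ... | yes x≡y = x≡y

  injective⇒sum-δ≤1 : ∀ {m} (f : Fin m → X) → (∀ {i j} → f i ≡ f j → i ≡ j) →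
                      ∀ y → ∑[ i < m ] δ (f i) y ≤ 1
  injective⇒sum-δ≤1 {zero}  f f-inj y = z≤n
  injective⇒sum-δ≤1 {suc m} f f-inj y with f zero ≟ y
  ... | yes refl = ≤-reflexive (cong suc (trans (Sum.sum-cong-≗ others-miss) (Sum.sum-replicate-zero m)))
    where
    others-miss : ∀ i → δ (f (suc i)) (f zero) ≡ 0
    others-miss i = δ-≢ (λ eq → Fin.0≢1+n (sym (f-inj eq)))
  ... | no _ = injective⇒sum-δ≤1 (λ i → f (suc i)) (λ eq → Fin.suc-injective (f-inj eq)) y

record Summation (X : Set) : Set where
  field
    _≟_         : DecidableEquality X
    ∑           : (X → ℕ) → ℕ
    ∑-cong      : ∀ {f g : X → ℕ} → (∀ x → f x ≡ g x) → ∑ f ≡ ∑ g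
    ∑-distrib-+ : ∀ f g → ∑ (λ x → f x + g x) ≡ ∑ f + ∑ g
    ∑-*ˡ        : ∀ c f → ∑ (λ x → c * f x) ≡ c * ∑ f
    ∑-δ         : ∀ x → ∑ (δ _≟_ x) ≡ 1
    ∑-witness   : ∀ f → 0 < ∑ f → ∃[ x ] 0 < f x

  ∑-zero : ∑ (λ _ → 0) ≡ 0
  ∑-zero = ∑-*ˡ 0 (λ _ → 0)

  ∑-*ʳ : ∀ (f : X → ℕ) c → ∑ (λ x → f x * c) ≡ ∑ f * c
  ∑-*ʳ f c = trans (∑-cong (λ x → *-comm (f x) c)) (trans (∑-*ˡ c f) (*-comm c (∑ f)))

  ∑-δ-* : ∀ x (f : X → ℕ) → ∑ (λ y → δ _≟_ x y * f y) ≡ f x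
  ∑-δ-* x f = begin
    ∑ (λ y → δ _≟_ x y * f y) ≡⟨ ∑-cong δ-*-f ⟩
    ∑ (λ y → δ _≟_ x y * f x) ≡⟨ ∑-*ʳ (δ _≟_ x) (f x) ⟩
    ∑ (δ _≟_ x) * f x         ≡⟨ cong (_* f x) (∑-δ x) ⟩
    1 * f x                   ≡⟨ *-identityˡ (f x) ⟩
    f x                       ∎
    where
    open ≡-Reasoning
    δ-*-f : ∀ y → δ _≟_ x y * f y ≡ δ _≟_ x y * f x
    δ-*-f y with x ≟ y
    ... | yes refl = refl
    ... | no _     = refl

  ∑-sum-comm : ∀ {m} (f : Fin m → X → ℕ) → ∑ (λ x → ∑[ i < m ] f i x) ≡ ∑[ i < m ] ∑ (f i)
  ∑-sum-comm {zero}  f = ∑-zero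
  ∑-sum-comm {suc m} f =
    trans (∑-distrib-+ _ _) (cong (∑ (f zero) +_) (∑-sum-comm (λ i → f (suc i))))

sum-witness : ∀ {n} (f : Fin n → ℕ) → 0 < sum f → ∃[ i ] 0 < f i
sum-witness {suc n} f 0<Σf with f zero in eq
... | suc _ = zero , subst (0 <_) (sym eq) (s≤s z≤n)
... | zero with sum-witness (λ i → f (suc i)) 0<Σf
...   | i , 0<fi = suc i , 0<fi

sum-δ : ∀ {n} (i : Fin n) → ∑[ j < n ] δ Fin._≟_ i j ≡ 1
sum-δ {suc n} zero    = cong suc (Sum.sum-replicate-zero n)
sum-δ {suc n} (suc i) = sum-δ i

sum-pos : ∀ {n} (f : Fin n → ℕ) i → 0 < f i → 0 < sum f
sum-pos {suc n} f i 0<fi =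
  ≤-trans 0<fi (≤-trans (m≤m+n (f i) _) (≤-reflexive (sym (Sum.sum-remove {i = i} f))))

sum-const : ∀ n c → ∑[ i < n ] c ≡ n * c
sum-const zero    c = refl
sum-const (suc n) c = cong (c +_) (sum-const n c)

finSummation : ∀ n → Summation (Fin n)
finSummation n = record
  { _≟_         = Fin._≟_
  ; ∑           = sum
  ; ∑-cong      = Sum.sum-cong-≗
  ; ∑-distrib-+ = Sum.∑-distrib-+
  ; ∑-*ˡ        = λ c f → sym (Sum.*-distribˡ-sum c f)
  ; ∑-δ         = sum-δ
  ; ∑-witness   = sum-witness
  }

module _ {A : Set} (S : Summation A) where
  open Summation S

  ∑ⱽ : ∀ m → (Vec A m → ℕ) → ℕ
  ∑ⱽ zero    f = f []
  ∑ⱽ (suc m) f = ∑ (λ a → ∑ⱽ m (λ v → f (a ∷ v)))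

  ∑ⱽ-cong : ∀ m {f g : Vec A m → ℕ} → (∀ v → f v ≡ g v) → ∑ⱽ m f ≡ ∑ⱽ m g
  ∑ⱽ-cong zero    f≗g = f≗g []
  ∑ⱽ-cong (suc m) f≗g = ∑-cong (λ a → ∑ⱽ-cong m (λ v → f≗g (a ∷ v)))

  ∑ⱽ-distrib-+ : ∀ m f g → ∑ⱽ m (λ v → f v + g v) ≡ ∑ⱽ m f + ∑ⱽ m g
  ∑ⱽ-distrib-+ zero    f g = refl
  ∑ⱽ-distrib-+ (suc m) f g = trans (∑-cong (λ a → ∑ⱽ-distrib-+ m _ _)) (∑-distrib-+ _ _)

  ∑ⱽ-*ˡ : ∀ m c f → ∑ⱽ m (λ v → c * f v) ≡ c * ∑ⱽ m f
  ∑ⱽ-*ˡ zero    c f = refl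
  ∑ⱽ-*ˡ (suc m) c f = trans (∑-cong (λ a → ∑ⱽ-*ˡ m c _)) (∑-*ˡ c _)

  -- δ (a ∷ w) (b ∷ v) unfolds to Bool→ℕ (does (a ≟ b) ∧ does (w ≟ v)).
  ∑ⱽ-δ : ∀ m w → ∑ⱽ m (δ (Vec.≡-dec _≟_) w) ≡ 1
  ∑ⱽ-δ zero    []      = refl
  ∑ⱽ-δ (suc m) (a ∷ w) = trans (∑-cong λ b → begin
      ∑ⱽ m (λ v → Bool→ℕ (does (a ≟ b) ∧ does (Vec.≡-dec _≟_ w v)))
        ≡⟨ ∑ⱽ-cong m (λ v → Bool→ℕ-∧ (does (a ≟ b)) _) ⟩
      ∑ⱽ m (λ v → δ _≟_ a b * δ (Vec.≡-dec _≟_) w v)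
        ≡⟨ ∑ⱽ-*ˡ m (δ _≟_ a b) _ ⟩
      δ _≟_ a b * ∑ⱽ m (δ (Vec.≡-dec _≟_) w)
        ≡⟨ cong (δ _≟_ a b *_) (∑ⱽ-δ m w) ⟩
      δ _≟_ a b * 1
        ≡⟨ *-identityʳ _ ⟩
      δ _≟_ a b ∎) (∑-δ a)
    where open ≡-Reasoning

  ∑ⱽ-witness : ∀ m f → 0 < ∑ⱽ m f → ∃[ v ] 0 < f v
  ∑ⱽ-witness zero    f pos = [] , pos
  ∑ⱽ-witness (suc m) f pos with ∑-witness _ pos
  ... | a , pos′ with ∑ⱽ-witness m _ pos′
  ...   | v , pos″ = a ∷ v , pos″

  vecSummation : ∀ m → Summation (Vec A m)
  vecSummation m = record
    { _≟_         = Vec.≡-dec _≟_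
    ; ∑           = ∑ⱽ m
    ; ∑-cong      = ∑ⱽ-cong m
    ; ∑-distrib-+ = ∑ⱽ-distrib-+ m
    ; ∑-*ˡ        = ∑ⱽ-*ˡ m
    ; ∑-δ         = ∑ⱽ-δ m
    ; ∑-witness   = ∑ⱽ-witness m
    }

≤1⇒≤ : ∀ {a b} → a ≤ 1 → (0 < a → 0 < b) → a ≤ b
≤1⇒≤ z≤n       _     = z≤n
≤1⇒≤ (s≤s z≤n) 0<a⇒0<b = 0<a⇒0<b (s≤s z≤n)

module Orbits {X : Set} (S : Summation X) (σ : X → X) {p : ℕ} (p-prime : Prime p)
              (σ^p≡id : ∀ x → fold x σ p ≡ x) where
  open Summation S

  private instance
    p≢0 : NonZero p
    p≢0 = prime⇒nonZero p-prime

  1≤p : 1 ≤ p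
  1≤p = >-nonZero⁻¹ p

  σ^-periodic : ∀ {x e} → fold x σ e ≡ x → ∀ q → fold x σ (q * e) ≡ x
  σ^-periodic           eq zero    = refl
  σ^-periodic {x} {e} eq (suc q) = begin
    fold x σ (e + q * e)          ≡⟨ fold-+ x σ e ⟩
    fold (fold x σ (q * e)) σ e   ≡⟨ cong (λ z → fold z σ e) (σ^-periodic eq q) ⟩
    fold x σ e                    ≡⟨ eq ⟩
    x                             ∎
    where open ≡-Reasoning

  σ^-mod : ∀ x j → fold x σ j ≡ fold x σ (j % p)
  σ^-mod x j = begin
    fold x σ j
      ≡⟨ cong (fold x σ) (m≡m%n+[m/n]*n j p) ⟩
    fold x σ (j % p + j / p * p)
      ≡⟨ fold-+ x σ (j % p) ⟩
    fold (fold x σ (j / p * p)) σ (j % p)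
      ≡⟨ cong (λ z → fold z σ (j % p)) (σ^-periodic (σ^p≡id x) (j / p)) ⟩
    fold x σ (j % p) ∎
    where open ≡-Reasoning

  -- A period coprime to p combines with p, by Bézout, into the period 1.
  fixed-of-period : ∀ {x e} → 0 < e → e < p → fold x σ e ≡ x → σ x ≡ x
  fixed-of-period {x} {e} 0<e e<p eq
    with coprime-Bézout (prime⇒coprime p-prime {{>-nonZero 0<e}} e<p)
  ... | Bézout.+- a b 1+be≡ap = begin
    σ x                    ≡⟨ cong σ (σ^-periodic eq b) ⟨
    fold x σ (1 + b * e)   ≡⟨ cong (fold x σ) 1+be≡ap ⟩
    fold x σ (a * p)       ≡⟨ σ^-periodic (σ^p≡id x) a ⟩
    x                      ∎
    where open ≡-Reasoning
  ... | Bézout.-+ a b 1+ap≡be = begin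
    σ x                    ≡⟨ cong σ (σ^-periodic (σ^p≡id x) a) ⟨
    fold x σ (1 + a * p)   ≡⟨ cong (fold x σ) 1+ap≡be ⟩
    fold x σ (b * e)       ≡⟨ σ^-periodic eq b ⟩
    x                      ∎
    where open ≡-Reasoning

  module Orbit (x : X) (σx≢x : σ x ≢ x) where

    orbit : Fin p → X
    orbit i = fold x σ (toℕ i)

    σ^-distinct : ∀ {i j} → i < j → j < p → fold x σ i ≢ fold x σ j
    σ^-distinct {i} {j} i<j j<p σⁱx≡σʲx = σx≢x (fixed-of-period 0<e e<p σᵉx≡x)
      where
      open ≡-Reasoning
      e : ℕ
      e = p ∸ j + i
      0<e : 0 < e
      0<e = ≤-trans (m<n⇒0<n∸m j<p) (m≤m+n (p ∸ j) i)
      e<p : e < p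
      e<p = subst (e <_) (m∸n+n≡m (<⇒≤ j<p)) (+-monoʳ-< (p ∸ j) i<j)
      σᵉx≡x : fold x σ e ≡ x
      σᵉx≡x = begin
        fold x σ (p ∸ j + i)          ≡⟨ fold-+ x σ (p ∸ j) ⟩
        fold (fold x σ i) σ (p ∸ j)   ≡⟨ cong (λ z → fold z σ (p ∸ j)) σⁱx≡σʲx ⟩
        fold (fold x σ j) σ (p ∸ j)   ≡⟨ fold-+ x σ (p ∸ j) ⟨
        fold x σ (p ∸ j + j)          ≡⟨ cong (fold x σ) (m∸n+n≡m (<⇒≤ j<p)) ⟩
        fold x σ p                    ≡⟨ σ^p≡id x ⟩
        x                             ∎

    orbit-injective : ∀ {i j} → orbit i ≡ orbit j → i ≡ j
    orbit-injective {i} {j} eq with <-cmp (toℕ i) (toℕ j)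
    ... | tri< i<j _ _ = contradiction eq (σ^-distinct i<j (Fin.toℕ<n j))
    ... | tri≈ _ i≡j _ = Fin.toℕ-injective i≡j
    ... | tri> _ _ j<i = contradiction (sym eq) (σ^-distinct j<i (Fin.toℕ<n i))

    -- Since orbit is injective, O is the indicator function of the orbit of x.
    O : X → ℕ
    O y = ∑[ i < p ] δ _≟_ (orbit i) y

    O≤1 : ∀ y → O y ≤ 1
    O≤1 = injective⇒sum-δ≤1 _≟_ orbit orbit-injective

    ∑O≡p : ∑ O ≡ p
    ∑O≡p = begin
      ∑ O                                  ≡⟨ ∑-sum-comm (λ i → δ _≟_ (orbit i)) ⟩
      ∑[ i < p ] ∑ (δ _≟_ (orbit i))       ≡⟨ Sum.sum-cong-≗ (λ i → ∑-δ (orbit i)) ⟩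
      ∑[ i < p ] 1                         ≡⟨ sum-const p 1 ⟩
      p * 1                                ≡⟨ *-identityʳ p ⟩
      p                                    ∎
      where open ≡-Reasoning

    Reachable : X → Set
    Reachable y = ∃[ j ] fold x σ j ≡ y

    reachable⇒0<O : ∀ {y} → Reachable y → 0 < O y
    reachable⇒0<O {y} (j , σʲx≡y) = sum-pos _ i (≤-reflexive (sym δ≡1))
      where
      i : Fin p
      i = fromℕ< (m%n<n j p)
      orbit≡y : orbit i ≡ y
      orbit≡y = trans (cong (fold x σ) (Fin.toℕ-fromℕ< (m%n<n j p))) (trans (sym (σ^-mod x j)) σʲx≡y)
      δ≡1 : δ _≟_ (orbit i) y ≡ 1
      δ≡1 = trans (cong (λ z → δ _≟_ z y) orbit≡y) (δ-refl _≟_ y)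

    0<O⇒reachable : ∀ {y} → 0 < O y → Reachable y
    0<O⇒reachable {y} 0<Oy with sum-witness (λ i → δ _≟_ (orbit i) y) 0<Oy
    ... | i , 0<δ = toℕ i , δ-pos _≟_ 0<δ

    reachable-σ : ∀ {y} → Reachable y → Reachable (σ y)
    reachable-σ (j , σʲx≡y) = suc j , cong σ σʲx≡y

    reachable-σ⁻¹ : ∀ {y} → Reachable (σ y) → Reachable y
    reachable-σ⁻¹ {y} (j , σʲx≡σy) = p ∸ 1 + j , (begin
      fold x σ (p ∸ 1 + j)          ≡⟨ fold-+ x σ (p ∸ 1) ⟩
      fold (fold x σ j) σ (p ∸ 1)   ≡⟨ cong (λ z → fold z σ (p ∸ 1)) σʲx≡σy ⟩
      fold (σ y) σ (p ∸ 1)          ≡⟨ fold-+ y σ (p ∸ 1) ⟨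
      fold y σ (p ∸ 1 + 1)          ≡⟨ cong (fold y σ) (m∸n+n≡m 1≤p) ⟩
      fold y σ p                    ≡⟨ σ^p≡id y ⟩
      y                             ∎)
      where open ≡-Reasoning

    O-σ : ∀ y → O (σ y) ≡ O y
    O-σ y = ≤-antisym
      (≤1⇒≤ (O≤1 (σ y)) (reachable⇒0<O ∘ reachable-σ⁻¹ ∘ 0<O⇒reachable))
      (≤1⇒≤ (O≤1 y) (reachable⇒0<O ∘ reachable-σ ∘ 0<O⇒reachable))

  Invariant : (X → ℕ) → Set
  Invariant h = ∀ y → h (σ y) ≡ h y

  ZeroOnFixedPoints : (X → ℕ) → Set
  ZeroOnFixedPoints h = ∀ y → σ y ≡ y → h y ≡ 0

  invariant-fold : ∀ {h} → Invariant h → ∀ z j → h (fold z σ j) ≡ h z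
  invariant-fold inv z zero    = refl
  invariant-fold inv z (suc j) = trans (inv (fold z σ j)) (invariant-fold inv z j)

  remove-orbit : ∀ h → Invariant h → ZeroOnFixedPoints h → 0 < ∑ h →
                 ∃[ h′ ] ∑ h ≡ ∑ h′ + p × Invariant h′ × ZeroOnFixedPoints h′
  remove-orbit h inv fix 0<∑h with ∑-witness h 0<∑h
  ... | x , 0<hx = (λ y → h y ∸ O y) , ∑h≡∑h′+p , inv′ , fix′
    where
    open Orbit x (λ σx≡x → contradiction (subst (0 <_) (fix x σx≡x) 0<hx) n≮0)

    O≤h : ∀ y → O y ≤ h y
    O≤h y = ≤1⇒≤ (O≤1 y) λ 0<Oy → case 0<O⇒reachable 0<Oy of λ where
      (j , σʲx≡y) → subst (0 <_) (trans (sym (invariant-fold inv x j)) (cong h σʲx≡y)) 0<hx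

    ∑h≡∑h′+p : ∑ h ≡ ∑ (λ y → h y ∸ O y) + p
    ∑h≡∑h′+p = begin
      ∑ h                                   ≡⟨ ∑-cong (λ y → m∸n+n≡m (O≤h y)) ⟨
      ∑ (λ y → h y ∸ O y + O y)             ≡⟨ ∑-distrib-+ _ O ⟩
      ∑ (λ y → h y ∸ O y) + ∑ O             ≡⟨ cong (∑ (λ y → h y ∸ O y) +_) ∑O≡p ⟩
      ∑ (λ y → h y ∸ O y) + p               ∎
      where open ≡-Reasoning

    inv′ : Invariant (λ y → h y ∸ O y)
    inv′ y = cong₂ _∸_ (inv y) (O-σ y)

    fix′ : ZeroOnFixedPoints (λ y → h y ∸ O y)
    fix′ y σy≡y = trans (cong (_∸ O y) (fix y σy≡y)) (0∸n≡0 (O y))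

  p∣∑-bounded : ∀ N h → ∑ h < N → Invariant h → ZeroOnFixedPoints h → p ∣ ∑ h
  p∣∑-bounded (suc N) h ∑h<1+N inv fix with ∑ h ℕ.≟ 0
  ... | yes ∑h≡0 = subst (p ∣_) (sym ∑h≡0) (p ∣0)
  ... | no  ∑h≢0 with remove-orbit h inv fix (n≢0⇒n>0 ∑h≢0)
  ...   | h′ , ∑h≡∑h′+p , inv′ , fix′ =
    subst (p ∣_) (sym ∑h≡∑h′+p) (∣m∣n⇒∣m+n (p∣∑-bounded N h′ ∑h′<N inv′ fix′) ∣-refl)
    where
    ∑h′<N : ∑ h′ < N
    ∑h′<N = <-≤-trans (m<m+n (∑ h′) 1≤p) (subst (_≤ N) ∑h≡∑h′+p (s≤s⁻¹ ∑h<1+N))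

  p∣∑ : ∀ h → Invariant h → ZeroOnFixedPoints h → p ∣ ∑ h
  p∣∑ h = p∣∑-bounded (suc (∑ h)) h (n<1+n (∑ h))

module _ {A : Set} where

  rotate : ∀ {m} → Vec A (suc m) → Vec A (suc m)
  rotate (a ∷ v) = v ∷ʳ a

  rotateᴸ : List A → List A
  rotateᴸ []       = []
  rotateᴸ (a ∷ xs) = xs ++ [ a ]

  fold-rotateᴸ-++ : ∀ xs ys → fold (xs ++ ys) rotateᴸ (length xs) ≡ ys ++ xs
  fold-rotateᴸ-++ []       ys = sym (++-identityʳ ys)
  fold-rotateᴸ-++ (x ∷ xs) ys = begin
    fold (x ∷ xs ++ ys) rotateᴸ (suc (length xs))
      ≡⟨ cong (fold _ rotateᴸ) (+-comm 1 (length xs)) ⟩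
    fold (x ∷ xs ++ ys) rotateᴸ (length xs + 1)
      ≡⟨ fold-+ _ rotateᴸ (length xs) ⟩
    fold ((xs ++ ys) ++ [ x ]) rotateᴸ (length xs)   ≡⟨ cong (λ zs → fold zs rotateᴸ (length xs))
                                                              (++-assoc xs ys [ x ]) ⟩
    fold (xs ++ ys ++ [ x ]) rotateᴸ (length xs)
      ≡⟨ fold-rotateᴸ-++ xs (ys ++ [ x ]) ⟩
    (ys ++ [ x ]) ++ xs
      ≡⟨ ++-assoc ys [ x ] xs ⟩
    ys ++ x ∷ xs ∎
    where open ≡-Reasoning

  toList-fold-rotate : ∀ {m} (v : Vec A (suc m)) j →
                       toList (fold v rotate j) ≡ fold (toList v) rotateᴸ j
  toList-fold-rotate v zero    = refl
  toList-fold-rotate v (suc j) with fold v rotate j | toList-fold-rotate v j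
  ... | a ∷ w | eq = trans (Vec.toList-∷ʳ a w) (cong rotateᴸ eq)

  rotate-period : ∀ {m} (v : Vec A (suc m)) → fold v rotate (suc m) ≡ v
  rotate-period {m} v = trans (sym (cast-is-id refl _)) (Vec.toList-injective refl _ v (begin
    toList (fold v rotate (suc m))
      ≡⟨ toList-fold-rotate v (suc m) ⟩
    fold xs rotateᴸ (suc m)
      ≡⟨ cong (fold xs rotateᴸ) (Vec.length-toList v) ⟨
    fold xs rotateᴸ (length xs)
      ≡⟨ cong (λ ys → fold ys rotateᴸ (length xs)) (++-identityʳ xs) ⟨
    fold (xs ++ []) rotateᴸ (length xs)
      ≡⟨ fold-rotateᴸ-++ xs [] ⟩
    xs ∎))
    where
    open ≡-Reasoning
    xs : List A
    xs = toList v

infix 4 _≡1[mod_]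

_≡1[mod_] : ℕ → ℕ → Set
x ≡1[mod p ] = ∃[ y ] p ∣ y × x ≡ 1 + y

≡1-* : ∀ {p x y} → x ≡1[mod p ] → y ≡1[mod p ] → x * y ≡1[mod p ]
≡1-* {p} (a , p∣a , refl) (b , p∣b , refl) =
  b + a * suc b , ∣m∣n⇒∣m+n p∣b (∣m⇒∣m*n (suc b) p∣a) , refl

≡1-^ : ∀ {p x} → x ≡1[mod p ] → ∀ e → x ^ e ≡1[mod p ]
≡1-^ {p} x≡1 zero    = 0 , p ∣0 , refl
≡1-^     x≡1 (suc e) = ≡1-* x≡1 (≡1-^ x≡1 e)

≡1-+∣ : ∀ {p x y} → x ≡1[mod p ] → p ∣ y → x + y ≡1[mod p ]
≡1-+∣ {y = y} (a , p∣a , refl) p∣y = a + y , ∣m∣n⇒∣m+n p∣a p∣y , refl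

≡1∧∣⇒≡1 : ∀ {p x} → x ≡1[mod p ] → p ∣ x → p ≡ 1
≡1∧∣⇒≡1 {p} (a , p∣a , refl) p∣1+a =
  ∣1⇒≡1 (∣m+n∣m⇒∣n (subst (p ∣_) (+-comm 1 a) p∣1+a) p∣a)

length-filterᵇ-tabulate : ∀ {A : Set} (P : A → Bool) {m} (f : Fin m → A) →
                          length (filterᵇ P (tabulate f)) ≡ ∑[ i < m ] Bool→ℕ (P (f i))
length-filterᵇ-tabulate P {zero}  f = refl
length-filterᵇ-tabulate P {suc m} f with P (f zero)
... | true  = cong suc (length-filterᵇ-tabulate P (f ∘ suc))
... | false = length-filterᵇ-tabulate P (f ∘ suc)

module Friendship {n : ℕ} (G : SimpleGraph n) {c : ℕ} (regular : IsRegular G (suc c))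
                  (c4-free : FourCycleFree G) (φ-complete : PhiComplete G) where
  open SimpleGraph G using (adj; irrefl) renaming (sym to adj-sym)
  open Summation (finSummation n)

  k : ℕ
  k = suc c

  A : Fin n → Fin n → ℕ
  A u w = Bool→ℕ (adj u w)

  A-sym : ∀ u w → A u w ≡ A w u
  A-sym u w = cong Bool→ℕ (adj-sym u w)

  ∑-A : ∀ u → ∑ (A u) ≡ k
  ∑-A u = trans (sym (length-filterᵇ-tabulate (adj u) id)) (regular u)

  ∑-A*A-diag : ∀ u → ∑ (λ a → A u a * A a u) ≡ k
  ∑-A*A-diag u = trans (∑-cong A*A≡A) (∑-A u)
    where
    A*A≡A : ∀ a → A u a * A a u ≡ A u a
    A*A≡A a = trans (cong (A u a *_) (A-sym a u))
                    (trans (sym (Bool→ℕ-∧ (adj u a) (adj u a))) (cong Bool→ℕ (∧-idem (adj u a))))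

  ∑-A*A-off-diag : ∀ {u w} → u ≢ w → ∑ (λ a → A u a * A a w) ≡ 1
  ∑-A*A-off-diag {u} {w} u≢w = begin
    ∑ (λ a → A u a * A a w)
      ≡⟨ ∑-cong (λ a → cong (A u a *_) (A-sym a w)) ⟩
    ∑ (λ a → A u a * A w a)
      ≡⟨ ∑-cong (λ a → Bool→ℕ-∧ (adj u a) (adj w a)) ⟨
    ∑ (λ a → Bool→ℕ (adj u a ∧ adj w a))
      ≡⟨ length-filterᵇ-tabulate (λ a → adj u a ∧ adj w a) id ⟨
    length (commonNeighbours G u w)
      ≡⟨ ≤-antisym (c4-free u w u≢w) (proj₂ (φ-complete u w u≢w)) ⟩
    1 ∎
    where open ≡-Reasoning

  A² : ∀ u w → ∑ (λ a → A u a * A a w) ≡ 1 + c * δ _≟_ u w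
  A² u w with u ≟ w
  ... | yes refl = trans (∑-A*A-diag u) (cong suc (sym (*-identityʳ c)))
  ... | no  u≢w  = trans (∑-A*A-off-diag u≢w) (cong suc (sym (*-zeroʳ c)))

  A²-apply : ∀ u (f : Fin n → ℕ) → ∑ (λ a → A u a * ∑ (λ b → A a b * f b)) ≡ ∑ f + c * f u
  A²-apply u f = begin
    ∑ (λ a → A u a * ∑ (λ b → A a b * f b))
      ≡⟨ ∑-cong (λ a → ∑-*ˡ (A u a) _) ⟨
    ∑ (λ a → ∑ (λ b → A u a * (A a b * f b)))
      ≡⟨ Sum.∑-comm (λ a b → A u a * (A a b * f b)) ⟩
    ∑ (λ b → ∑ (λ a → A u a * (A a b * f b)))
      ≡⟨ ∑-cong (λ b → ∑-cong (λ a → *-assoc (A u a) (A a b) (f b))) ⟨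
    ∑ (λ b → ∑ (λ a → A u a * A a b * f b))
      ≡⟨ ∑-cong (λ b → ∑-*ʳ (λ a → A u a * A a b) (f b)) ⟩
    ∑ (λ b → ∑ (λ a → A u a * A a b) * f b)
      ≡⟨ ∑-cong (λ b → cong (_* f b) (A² u b)) ⟩
    ∑ (λ b → (1 + c * δ _≟_ u b) * f b)
      ≡⟨ ∑-cong (λ b → expand (δ _≟_ u b) (f b)) ⟩
    ∑ (λ b → f b + c * (δ _≟_ u b * f b))
      ≡⟨ ∑-distrib-+ f _ ⟩
    ∑ f + ∑ (λ b → c * (δ _≟_ u b * f b))
      ≡⟨ cong (∑ f +_) (∑-*ˡ c _) ⟩
    ∑ f + c * ∑ (λ b → δ _≟_ u b * f b)
      ≡⟨ cong (λ t → ∑ f + c * t) (∑-δ-* u f) ⟩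
    ∑ f + c * f u ∎
    where
    open ≡-Reasoning
    expand : ∀ d x → (1 + c * d) * x ≡ x + c * (d * x)
    expand d x = trans (*-distribʳ-+ x 1 (c * d)) (cong₂ _+_ (*-identityˡ x) (*-assoc c d x))

  walk : ∀ {m} → Fin n → Vec (Fin n) m → Fin n → ℕ
  walk u []      w = A u w
  walk u (a ∷ v) w = A u a * walk a v w

  -- walks m u w = (Aᵐ⁺¹) u w, written as a sum over the m inner vertices of a walk from u to w.
  walks : ℕ → Fin n → Fin n → ℕ
  walks m u w = ∑ⱽ (finSummation n) m (λ v → walk u v w)

  walks-suc : ∀ m u w → walks (suc m) u w ≡ ∑ (λ a → A u a * walks m a w)
  walks-suc m u w = ∑-cong (λ a → ∑ⱽ-*ˡ (finSummation n) m (A u a) (λ v → walk a v w))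

  ∑-walks : ∀ m u → ∑ (walks m u) ≡ k ^ suc m
  ∑-walks zero    u = trans (∑-A u) (sym (*-identityʳ k))
  ∑-walks (suc m) u = begin
    ∑ (walks (suc m) u)                          ≡⟨ ∑-cong (walks-suc m u) ⟩
    ∑ (λ w → ∑ (λ a → A u a * walks m a w))      ≡⟨ Sum.∑-comm (λ w a → A u a * walks m a w) ⟩
    ∑ (λ a → ∑ (λ w → A u a * walks m a w))      ≡⟨ ∑-cong (λ a → ∑-*ˡ (A u a) (walks m a)) ⟩
    ∑ (λ a → A u a * ∑ (walks m a))              ≡⟨ ∑-cong (λ a → cong (A u a *_) (∑-walks m a)) ⟩
    ∑ (λ a → A u a * k ^ suc m)                  ≡⟨ ∑-*ʳ (A u) (k ^ suc m) ⟩
    ∑ (A u) * k ^ suc m                          ≡⟨ cong (_* k ^ suc m) (∑-A u) ⟩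
    k ^ suc (suc m)                              ∎
    where open ≡-Reasoning

  walks-diag : ∀ m u → walks (2+ m) u u ≡ ∑ (λ b → walks m b u) + c * walks m u u
  walks-diag m u = begin
    walks (2+ m) u u
      ≡⟨ walks-suc (suc m) u u ⟩
    ∑ (λ a → A u a * walks (suc m) a u)
      ≡⟨ ∑-cong (λ a → cong (A u a *_) (walks-suc m a u)) ⟩
    ∑ (λ a → A u a * ∑ (λ b → A a b * walks m b u))
      ≡⟨ A²-apply u (λ b → walks m b u) ⟩
    ∑ (λ b → walks m b u) + c * walks m u u ∎
    where open ≡-Reasoning

  closedWalks : ℕ → ℕ
  closedWalks m = ∑ (λ u → walks m u u)

  closedWalks-1 : closedWalks 1 ≡ n * k
  closedWalks-1 = trans (∑-cong ∑-A*A-diag) (sum-const n k)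

  closedWalks-2+ : ∀ m → closedWalks (2+ m) ≡ n * k ^ suc m + c * closedWalks m
  closedWalks-2+ m = begin
    ∑ (λ u → walks (2+ m) u u)
      ≡⟨ ∑-cong (walks-diag m) ⟩
    ∑ (λ u → ∑ (λ b → walks m b u) + c * walks m u u)
      ≡⟨ ∑-distrib-+ _ _ ⟩
    ∑ (λ u → ∑ (λ b → walks m b u)) + ∑ (λ u → c * walks m u u)
      ≡⟨ cong₂ _+_ (Sum.∑-comm (λ u b → walks m b u)) (∑-*ˡ c _) ⟩
    ∑ (λ b → ∑ (walks m b)) + c * closedWalks m
      ≡⟨ cong (_+ c * closedWalks m) (∑-cong (∑-walks m)) ⟩
    ∑ (λ b → k ^ suc m) + c * closedWalks m
      ≡⟨ cong (_+ c * closedWalks m) (sum-const n (k ^ suc m)) ⟩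
    n * k ^ suc m + c * closedWalks m ∎
    where open ≡-Reasoning

  closedWeight : ∀ {m} → Vec (Fin n) (suc m) → ℕ
  closedWeight (u ∷ v) = walk u v u

  walk-∷ʳ : ∀ {m} u (v : Vec (Fin n) m) a w → walk u (v ∷ʳ a) w ≡ walk u v a * A a w
  walk-∷ʳ u []      a w = refl
  walk-∷ʳ u (b ∷ v) a w =
    trans (cong (A u b *_) (walk-∷ʳ b v a w)) (sym (*-assoc (A u b) (walk b v a) (A a w)))

  closedWeight-rotate : ∀ {m} (v : Vec (Fin n) (suc m)) → closedWeight (rotate v) ≡ closedWeight v
  closedWeight-rotate (a ∷ [])    = refl
  closedWeight-rotate (a ∷ b ∷ v) = trans (walk-∷ʳ b v a b) (*-comm (walk b v a) (A a b))

  closedWeight-fixed : ∀ {m} (v : Vec (Fin n) (suc m)) → rotate v ≡ v → closedWeight v ≡ 0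
  closedWeight-fixed (a ∷ [])    _ = cong Bool→ℕ (irrefl a)
  closedWeight-fixed (a ∷ b ∷ v) rotate-v≡v with Vec.∷-injectiveˡ rotate-v≡v
  ... | refl = cong (_* walk a v a) (cong Bool→ℕ (irrefl a))

  -- closedWalks m is definitionally the sum of closedWeight over Vec (Fin n) (suc m).
  prime∣closedWalks : ∀ {m} → Prime (suc m) → suc m ∣ closedWalks m
  prime∣closedWalks {m} p-prime =
    Orbits.p∣∑ (vecSummation (finSummation n) (suc m)) rotate p-prime rotate-period
               closedWeight closedWeight-rotate closedWeight-fixed

  module _ (n≡1+ck : n ≡ 1 + c * k) {p} (p∣c : p ∣ c) where

    k≡1 : k ≡1[mod p ]
    k≡1 = c , p∣c , refl

    n≡1 : n ≡1[mod p ]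
    n≡1 = c * k , ∣m⇒∣m*n k p∣c , n≡1+ck

    closedWalks≡1 : ∀ m → closedWalks (suc m) ≡1[mod p ]
    closedWalks≡1 zero    = subst (_≡1[mod p ]) (sym closedWalks-1) (≡1-* n≡1 k≡1)
    closedWalks≡1 (suc m) = subst (_≡1[mod p ]) (sym (closedWalks-2+ m))
      (≡1-+∣ (≡1-* n≡1 (≡1-^ k≡1 (suc m))) (∣m⇒∣m*n (closedWalks m) p∣c))

  prime∤c : n ≡ 1 + c * k → ∀ {p} → Prime p → ¬ p ∣ c
  prime∤c n≡1+ck {2+ m} p-prime p∣c =
    contradiction (≡1∧∣⇒≡1 (closedWalks≡1 n≡1+ck p∣c m) (prime∣closedWalks p-prime)) λ ()

prime-divisor : ∀ m → ∃[ p ] Prime p × p ∣ 2+ m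
prime-divisor m with factorise (2+ m)
... | record { factors = p ∷ ps ; isFactorisation = 2+m≡p*∏ps ; factorsPrime = p-prime ∷ _ } =
  p , p-prime , divides (product ps) (trans 2+m≡p*∏ps (*-comm p (product ps)))

d*d∸d+1≡1+c*d : ∀ c → suc c * suc c ∸ suc c + 1 ≡ 1 + c * suc c
d*d∸d+1≡1+c*d c = trans (cong (_+ 1) (m+n∸m≡n (suc c) (c * suc c))) (+-comm (c * suc c) 1)

lemma3p10 : (n d : ℕ) (G : SimpleGraph n) →
    3 ≤ n → IsRegular G d → IsConnected G → FourCycleFree G →
    PhiComplete G → n ≡ d * d ∸ d + 1 → d ≡ 2
lemma3p10 _ 0 _ 3≤1 _ _ _ _ refl = contradiction 3≤1 λ { (s≤s ()) }
lemma3p10 _ 1 _ 3≤1 _ _ _ _ refl = contradiction 3≤1 λ { (s≤s ()) }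
lemma3p10 _ 2 _ _ _ _ _ _ _ = refl
lemma3p10 n (2+ (suc e)) G _ regular _ c4-free φ-complete n≡d*d∸d+1 with prime-divisor e
... | p , p-prime , p∣c = contradiction p∣c (Friendship.prime∤c G regular c4-free φ-complete
                                               (trans n≡d*d∸d+1 (d*d∸d+1≡1+c*d (2+ e))) p-prime)
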